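{- Let $j,a\in\mathbb{N}$, $r\in\mathbb{N}_0$, and $p$ a prime. Then \[c_j^{(r)}(p^a)=\binom{a+r-1}{j+r-1}.\]
   Context: For $j\in\mathbb{N}$, $c_j(n)$ is the number of ordered tuples $(m_1,\dots,m_j)$ of integers $m_i\ge2$ with $m_1\cdots m_j=n$. The associated divisor functions are $c_j^{(0)}=c_j$ and $c_j^{(r)}(n)=\sum_{m\mid n}c_j^{(r-1)}(m)$ for $r,n\in\mathbb{N}$. Binomial coefficients $\binom{N}{K}$ with $K>N\ge0$ are $0$. -}

module Defs where

open import Data.Nat using (ℕ; zero; suc; _+_; _*_; _≟_)
open import Data.Nat.Divisibility using (_∣?_)
open import Data.List using (List; []; _∷_; map; concatMap; filter; length; upTo)
open import Data.Vec using (Vec; []; _∷_; toList)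
open import Data.Nat.ListAction using (sum; product)

vecsFrom : {A : Set} → List A → (j : ℕ) → List (Vec A j)
vecsFrom xs zero = [] ∷ []
vecsFrom xs (suc j) = concatMap (λ x → map (x ∷_) (vecsFrom xs j)) xs

-- the integers 2, 3, …, n  (every factor m_i ≥ 2 of n ≥ 1 satisfies m_i ≤ n)
range2 : ℕ → List ℕ
range2 n = map (λ k → k + 2) (upTo (n Data.Nat.∸ 1))

c : ℕ → ℕ → ℕ
c j n = length (filter (λ v → product (toList v) ≟ n) (vecsFrom (range2 n) j))

divisors : ℕ → List ℕ
divisors n = filter (λ m → m ∣? n) (map suc (upTo n))

cr : ℕ → ℕ → ℕ → ℕ
cr j zero n = c j n
cr j (suc r) n = sum (map (cr j r) (divisors n))

-- The divisors of p ^ n are p ^ 0, …, p ^ n, so c^{(r+1)}_j (p ^ n) = Σ_{d ≤ n} c^{(r)}_j (p ^ d).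
-- Splitting off the first factor p ^ e (e ≥ 1) of a factorisation of p ^ n gives
-- c_{j+1} (p ^ n) = Σ_{d < n} c_j (p ^ d), so c_{j+1} (p ^ n) = (n - 1) C j, the number of compositions
-- of n into j + 1 parts. By the hockey-stick identity Σ_{m < M} m C k = M C (k + 1), each further
-- divisor sum raises both entries of the binomial coefficient by one.

module Submission where

open import Defs
open import Data.Nat
open import Data.Nat.Properties
open import Data.Nat.Divisibility
open import Data.Nat.DivMod using (m*n/n≡m; n/1≡n)
open import Data.Nat.Primality using (Prime; prime⇒irreducible; prime⇒nonZero; prime⇒nonTrivial)
open import Data.Nat.Coprimality using (Coprime; coprime-divisor)
open import Data.Nat.Combinatorics using (_C_; k>n⇒nCk≡0; nCk+nC[k+1]≡[n+1]C[k+1])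
open import Data.Nat.ListAction using (sum; product)
open import Data.List using (List; []; _∷_; _++_; map; concatMap; filter; length; upTo; applyUpTo)
open import Data.List.Properties using (filter-++; length-++; filter-≐; filter-none; map-upTo; map-cong)
open import Data.List.Relation.Unary.All using (universal)
open import Data.Vec using (Vec; []; _∷_; toList)
open import Data.Product using (_,_)
open import Data.Sum using (_⊎_; inj₁; inj₂)
open import Data.Empty using (⊥-elim)
open import Function using (_∘_)
open import Relation.Nullary using (Dec; yes; no)
open import Relation.Unary using (Decidable)
open import Relation.Binary.PropositionalEquality
open import Algebra.Properties.CommutativeSemigroup +-commutativeSemigroup using (interchange; xy∙z≈xz∙y)

∑< : ℕ → (ℕ → ℕ) → ℕ
∑< zero    f = 0
∑< (suc n) f = ∑< n f + f n

∑<-sucˡ : ∀ n f → ∑< (suc n) f ≡ f 0 + ∑< n (f ∘ suc)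
∑<-sucˡ zero    f = +-comm 0 (f 0)
∑<-sucˡ (suc n) f = begin
  ∑< (suc n) f + f (suc n)             ≡⟨ cong (_+ f (suc n)) (∑<-sucˡ n f) ⟩
  f 0 + ∑< n (f ∘ suc) + f (suc n)     ≡⟨ +-assoc (f 0) _ _ ⟩
  f 0 + (∑< n (f ∘ suc) + f (suc n))   ∎
  where open ≡-Reasoning

∑<-cong : ∀ n {f g} → (∀ {i} → i < n → f i ≡ g i) → ∑< n f ≡ ∑< n g
∑<-cong zero    eq = refl
∑<-cong (suc n) eq = cong₂ _+_ (∑<-cong n (eq ∘ m<n⇒m<1+n)) (eq ≤-refl)

∑<-+ : ∀ n f g → ∑< n (λ i → f i + g i) ≡ ∑< n f + ∑< n g
∑<-+ zero    f g = refl
∑<-+ (suc n) f g = trans (cong (_+ (f n + g n)) (∑<-+ n f g)) (interchange (∑< n f) (∑< n g) (f n) (g n))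

∑<-0 : ∀ n → ∑< n (λ _ → 0) ≡ 0
∑<-0 zero    = refl
∑<-0 (suc n) = trans (+-identityʳ _) (∑<-0 n)

∑<-shift : ∀ m n f → ∑< m (λ i → f (i + n)) + ∑< n f ≡ ∑< (m + n) f
∑<-shift zero    n f = refl
∑<-shift (suc m) n f = trans (xy∙z≈xz∙y (∑< m (λ i → f (i + n))) (f (m + n)) (∑< n f)) (cong (_+ f (m + n)) (∑<-shift m n f))

∑<-reverse : ∀ n f → ∑< n (λ i → f (n ∸ suc i)) ≡ ∑< n f
∑<-reverse zero    f = refl
∑<-reverse (suc n) f = begin
  ∑< (suc n) (λ i → f (n ∸ i))      ≡⟨ ∑<-sucˡ n _ ⟩
  f n + ∑< n (λ i → f (n ∸ suc i))  ≡⟨ cong (f n +_) (∑<-reverse n f) ⟩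
  f n + ∑< n f                      ≡⟨ +-comm (f n) _ ⟩
  ∑< n f + f n                      ∎
  where open ≡-Reasoning

sum-map-applyUpTo : ∀ n (g f : ℕ → ℕ) → sum (map g (applyUpTo f n)) ≡ ∑< n (g ∘ f)
sum-map-applyUpTo zero    g f = refl
sum-map-applyUpTo (suc n) g f =
  trans (cong (g (f 0) +_) (sum-map-applyUpTo n g (f ∘ suc))) (sym (∑<-sucˡ n (g ∘ f)))

∑<-C : ∀ n k → ∑< n (_C k) ≡ n C suc k
∑<-C zero    k = refl
∑<-C (suc n) k = begin
  ∑< n (_C k) + n C k      ≡⟨ cong (_+ n C k) (∑<-C n k) ⟩
  n C suc k + n C k        ≡⟨ +-comm (n C suc k) (n C k) ⟩
  n C k + n C suc k        ≡⟨ nCk+nC[k+1]≡[n+1]C[k+1] n k ⟩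
  suc n C suc k            ∎
  where open ≡-Reasoning

-- (n - 1) C k, the number of compositions of n into k + 1 positive parts; at n = 0 it is 0,
-- whereas (0 ∸ 1) C 0 = 1
infixl 6.5 _C⁻_

_C⁻_ : ℕ → ℕ → ℕ
zero  C⁻ k = 0
suc n C⁻ k = n C k

∑<-C⁻ : ∀ n k → ∑< n (_C⁻ k) ≡ n C⁻ suc k
∑<-C⁻ zero    k = refl
∑<-C⁻ (suc n) k = trans (∑<-sucˡ n (_C⁻ k)) (∑<-C n k)

n≤1+k⇒nC⁻1+k≡0 : ∀ {n k} → n ≤ suc k → n C⁻ suc k ≡ 0
n≤1+k⇒nC⁻1+k≡0 {zero}  _         = refl
n≤1+k⇒nC⁻1+k≡0 {suc n} (s≤s n≤k) = k>n⇒nCk≡0 (s≤s n≤k)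

∑<-C⁻-shift : ∀ n r k → r ≤ suc k → ∑< n (λ d → (d + r) C⁻ k) ≡ (n + r) C⁻ suc k
∑<-C⁻-shift n r k r≤1+k = begin
  S                       ≡⟨ +-identityʳ S ⟨
  S + 0                   ≡⟨ cong (S +_) (trans (∑<-C⁻ r k) (n≤1+k⇒nC⁻1+k≡0 r≤1+k)) ⟨
  S + ∑< r (_C⁻ k)        ≡⟨ ∑<-shift n r (_C⁻ k) ⟩
  ∑< (n + r) (_C⁻ k)      ≡⟨ ∑<-C⁻ (n + r) k ⟩
  (n + r) C⁻ suc k        ∎
  where
  open ≡-Reasoning
  S : ℕ
  S = ∑< n (λ d → (d + r) C⁻ k)

indicator : {A : Set} → Dec A → ℕ → ℕ
indicator (yes _) v = v
indicator (no  _) v = 0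

module _ {A : Set} {P : A → Set} (P? : Decidable P) where

  sum-map-filter : ∀ (f : A → ℕ) xs → sum (map f (filter P? xs)) ≡ sum (map (λ x → indicator (P? x) (f x)) xs)
  sum-map-filter f []       = refl
  sum-map-filter f (x ∷ xs) with P? x
  ... | yes _ = cong (f x +_) (sum-map-filter f xs)
  ... | no  _ = sum-map-filter f xs

  length-filter-map : ∀ {B : Set} (g : B → A) xs → length (filter P? (map g xs)) ≡ length (filter (P? ∘ g) xs)
  length-filter-map g []       = refl
  length-filter-map g (x ∷ xs) with P? (g x)
  ... | yes _ = cong suc (length-filter-map g xs)
  ... | no  _ = length-filter-map g xs

  length-filter-concatMap : ∀ {B : Set} (g : B → List A) xs →
    length (filter P? (concatMap g xs)) ≡ sum (map (λ x → length (filter P? (g x))) xs)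
  length-filter-concatMap g []       = refl
  length-filter-concatMap g (x ∷ xs) = begin
    length (filter P? (g x ++ concatMap g xs))
      ≡⟨ cong length (filter-++ P? (g x) (concatMap g xs)) ⟩
    length (filter P? (g x) ++ filter P? (concatMap g xs))
      ≡⟨ length-++ (filter P? (g x)) ⟩
    length (filter P? (g x)) + length (filter P? (concatMap g xs))
      ≡⟨ cong (length (filter P? (g x)) +_) (length-filter-concatMap g xs) ⟩
    length (filter P? (g x)) + sum (map (λ y → length (filter P? (g y))) xs) ∎
    where open ≡-Reasoning

length-filter-[_] : ∀ {A : Set} {P : A → Set} x (P? : Decidable P) → length (filter P? (x ∷ [])) ≡ indicator (P? x) 1
length-filter-[ x ] P? with P? x
... | yes _ = refl
... | no  _ = refl

∑<-indicator-≟-absent : ∀ {m} N (f : ℕ → ℕ) → N < m → ∑< N (λ i → indicator (suc i ≟ m) (f (suc i))) ≡ 0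
∑<-indicator-≟-absent zero    f _ = refl
∑<-indicator-≟-absent {m} (suc N) f N<m with suc N ≟ m
... | yes refl = ⊥-elim (<-irrefl refl N<m)
... | no  _    = trans (+-identityʳ _) (∑<-indicator-≟-absent N f (<-trans (n<1+n N) N<m))

∑<-indicator-≟ : ∀ {m} N (f : ℕ → ℕ) → 0 < m → m ≤ N → ∑< N (λ i → indicator (suc i ≟ m) (f (suc i))) ≡ f m
∑<-indicator-≟ zero    f 0<m m≤0 = ⊥-elim (<⇒≱ 0<m m≤0)
∑<-indicator-≟ {m} (suc N) f 0<m m≤1+N with suc N ≟ m
... | yes refl = cong (_+ f (suc N)) (∑<-indicator-≟-absent N f (n<1+n N))
... | no  1+N≢m = trans (+-identityʳ _)
  (∑<-indicator-≟ N f 0<m (m<1+n⇒m≤n (≤∧≢⇒< m≤1+N (1+N≢m ∘ sym))))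

∑∣≤ : ℕ → ℕ → (ℕ → ℕ) → ℕ
∑∣≤ N n f = ∑< N (λ i → indicator (suc i ∣? n) (f (suc i)))

sum-map-divisors : ∀ n f → sum (map f (divisors n)) ≡ ∑∣≤ n n f
sum-map-divisors n f = begin
  sum (map f (divisors n))                                          ≡⟨ sum-map-filter (_∣? n) f (map suc (upTo n)) ⟩
  sum (map (λ x → indicator (x ∣? n) (f x)) (map suc (upTo n)))    ≡⟨ cong (sum ∘ map _) (map-upTo suc n) ⟩
  sum (map (λ x → indicator (x ∣? n) (f x)) (applyUpTo suc n))     ≡⟨ sum-map-applyUpTo n _ suc ⟩
  ∑∣≤ n n f                                                         ∎
  where open ≡-Reasoning

-- total division with the junk value m /′ 0 = 0, so that codivisors can be taken inside sums over ℕ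
infixl 7 _/′_

_/′_ : ℕ → ℕ → ℕ
m /′ zero  = 0
m /′ suc n = m / suc n

m*n/′n≡m : ∀ m n → 0 < n → m * n /′ n ≡ m
m*n/′n≡m m (suc n) _ = m*n/n≡m m (suc n)

-- The candidate factors L are fixed, whereas c n draws them from range2 n: splitting off a
-- factor lowers the target but must keep the list, and range2 (p ^ K) serves every p ^ n, n ≤ K.
factorisations : List ℕ → ℕ → ℕ → ℕ
factorisations L j m = length (filter (λ v → product (toList v) ≟ m) (vecsFrom L j))

factorisations-zero : ∀ L m → factorisations L 0 m ≡ indicator (1 ≟ m) 1
factorisations-zero L m = length-filter-[ [] ] (λ v → product (toList v) ≟ m)

length-filter-*≟ : ∀ {A : Set} (g : A → ℕ) x m (V : List A) →
  length (filter (λ v → suc x * g v ≟ m) V) ≡ indicator (suc x ∣? m) (length (filter (λ v → g v ≟ m /′ suc x) V))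
length-filter-*≟ g x m V with suc x ∣? m
... | yes (divides k refl) = cong length (filter-≐ _ _ (cancel , uncancel) V)
  where
  cancel : ∀ {v} → suc x * g v ≡ k * suc x → g v ≡ k * suc x / suc x
  cancel {v} eq = trans (*-cancelˡ-≡ (g v) k (suc x) (trans eq (*-comm k (suc x)))) (sym (m*n/n≡m k (suc x)))
  uncancel : ∀ {v} → g v ≡ k * suc x / suc x → suc x * g v ≡ k * suc x
  uncancel eq = trans (cong (suc x *_) (trans eq (m*n/n≡m k (suc x)))) (*-comm (suc x) k)
... | no  x∤m = cong length (filter-none _ (universal x∤m⇒≢ V))
  where
  x∤m⇒≢ : ∀ v → suc x * g v ≢ m
  x∤m⇒≢ v eq = x∤m (divides (g v) (trans (sym eq) (*-comm (suc x) (g v))))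

factorisations-suc : ∀ L j m → factorisations L (suc j) m ≡
  sum (map (λ x → length (filter (λ v → x * product (toList v) ≟ m) (vecsFrom L j))) L)
factorisations-suc L j m =
  trans (length-filter-concatMap P? (λ x → map (x ∷_) (vecsFrom L j)) L)
        (cong sum (map-cong (λ x → length-filter-map P? (x ∷_) (vecsFrom L j)) L))
  where
  P? : Decidable (λ (v : Vec ℕ (suc j)) → product (toList v) ≡ m)
  P? v = product (toList v) ≟ m

factorisations-range2-suc : ∀ N j m → 0 < N →
  factorisations (range2 N) j m + factorisations (range2 N) (suc j) m ≡
  ∑∣≤ N m (λ x → factorisations (range2 N) j (m /′ x))
factorisations-range2-suc (suc N) j m _ = begin
  F m + factorisations L (suc j) m
    ≡⟨ cong (F m +_) (factorisations-suc L j m) ⟩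
  F m + sum (map k L)
    ≡⟨ cong (λ xs → F m + sum (map k xs)) (map-upTo (_+ 2) N) ⟩
  F m + sum (map k (applyUpTo (_+ 2) N))
    ≡⟨ cong₂ _+_ (sym h1≡Fm) (sum-map-applyUpTo N k (_+ 2)) ⟩
  h 1 + ∑< N (λ i → k (i + 2))
    ≡⟨ cong (h 1 +_) (∑<-cong N (λ {i} _ → trans (cong k (+-comm i 2))
                                        (length-filter-*≟ (product ∘ toList) (suc i) m (vecsFrom L j)))) ⟩
  h 1 + ∑< N (λ i → h (suc (suc i)))
    ≡⟨ ∑<-sucˡ N (h ∘ suc) ⟨
  ∑∣≤ (suc N) m (F ∘ (m /′_))
    ∎
  where
  open ≡-Reasoning
  L : List ℕ
  L = range2 (suc N)
  F : ℕ → ℕ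
  F = factorisations L j
  k : ℕ → ℕ
  k x = length (filter (λ v → x * product (toList v) ≟ m) (vecsFrom L j))
  h : ℕ → ℕ
  h x = indicator (x ∣? m) (F (m /′ x))
  -- range2 omits the factor 1, whose term is the F m on the left
  h1≡Fm : h 1 ≡ F m
  h1≡Fm with 1 ∣? m
  ... | yes _ = cong F (n/1≡n m)
  ... | no 1∤m = ⊥-elim (1∤m (1∣ m))

module PrimePower {p : ℕ} (prime-p : Prime p) where

  instance
    p≢0 : NonZero p
    p≢0 = prime⇒nonZero prime-p

    p^n≢0 : ∀ {n} → NonZero (p ^ n)
    p^n≢0 {n} = m^n≢0 p n

  1<p : 1 < p
  1<p = nonTrivial⇒n>1 p {{prime⇒nonTrivial prime-p}}

  p^n<p^1+n : ∀ n → p ^ n < p ^ suc n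
  p^n<p^1+n n = ^-monoʳ-< p 1<p (n<1+n n)

  ∣p^1+n⇒∣p^n⊎≡p^1+n : ∀ n {x} → x ∣ p ^ suc n → x ∣ p ^ n ⊎ x ≡ p ^ suc n
  ∣p^1+n⇒∣p^n⊎≡p^1+n zero {x} x∣p with prime⇒irreducible prime-p (subst (x ∣_) (*-identityʳ p) x∣p)
  ... | inj₁ refl = inj₁ ∣-refl
  ... | inj₂ refl = inj₂ (sym (*-identityʳ p))
  ∣p^1+n⇒∣p^n⊎≡p^1+n (suc n) {x} x∣ with p ∣? x
  ... | yes (divides y refl)
    with ∣p^1+n⇒∣p^n⊎≡p^1+n n {y} (*-cancelʳ-∣ p (subst (y * p ∣_) (*-comm p (p ^ suc n)) x∣))
  ...   | inj₁ y∣p^n = inj₁ (subst (y * p ∣_) (*-comm (p ^ n) p) (*-monoˡ-∣ p y∣p^n))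
  ...   | inj₂ refl  = inj₂ (*-comm (p ^ suc n) p)
  ∣p^1+n⇒∣p^n⊎≡p^1+n (suc n) {x} x∣ | no p∤x = inj₁ (coprime-divisor x⊥p x∣)
    where
    x⊥p : Coprime x p
    x⊥p (i∣x , i∣p) with prime⇒irreducible prime-p i∣p
    ... | inj₁ i≡1 = i≡1
    ... | inj₂ refl = ⊥-elim (p∤x i∣x)

  indicator-∣p^1+n : ∀ n x v →
    indicator (x ∣? p ^ suc n) v ≡ indicator (x ∣? p ^ n) v + indicator (x ≟ p ^ suc n) v
  indicator-∣p^1+n n x v with x ∣? p ^ suc n | x ∣? p ^ n | x ≟ p ^ suc n
  ... | yes _ | yes x∣p^n | yes refl = ⊥-elim (<⇒≱ (p^n<p^1+n n) (∣⇒≤ {{p^n≢0 {n}}} x∣p^n))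
  ... | yes _ | yes _     | no  _    = sym (+-identityʳ v)
  ... | yes _ | no  _     | yes _    = refl
  ... | yes x∣ | no x∤p^n | no x≢p^1+n with ∣p^1+n⇒∣p^n⊎≡p^1+n n x∣
  ...   | inj₁ x∣p^n   = ⊥-elim (x∤p^n x∣p^n)
  ...   | inj₂ x≡p^1+n = ⊥-elim (x≢p^1+n x≡p^1+n)
  indicator-∣p^1+n n x v | no x∤ | yes x∣p^n | _    = ⊥-elim (x∤ (∣-trans x∣p^n (n∣m*n p)))
  indicator-∣p^1+n n x v | no x∤ | no _      | yes refl = ⊥-elim (x∤ ∣-refl)
  indicator-∣p^1+n n x v | no _  | no _      | no _ = refl

  ∑∣≤-p^ : ∀ n N f → p ^ n ≤ N → ∑∣≤ N (p ^ n) f ≡ ∑< (suc n) (f ∘ (p ^_))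
  ∑∣≤-p^ zero N f 1≤N = begin
    ∑∣≤ N 1 f                                          ≡⟨ ∑<-cong N (λ {i} _ → ∣1⇔≡1 (suc i) (f (suc i))) ⟩
    ∑< N (λ i → indicator (suc i ≟ 1) (f (suc i)))    ≡⟨ ∑<-indicator-≟ N f ≤-refl 1≤N ⟩
    f 1                                                ∎
    where
    open ≡-Reasoning
    ∣1⇔≡1 : ∀ x v → indicator (x ∣? 1) v ≡ indicator (x ≟ 1) v
    ∣1⇔≡1 x v with x ∣? 1 | x ≟ 1
    ... | yes _   | yes _    = refl
    ... | yes x∣1 | no  x≢1  = ⊥-elim (x≢1 (∣1⇒≡1 x∣1))
    ... | no  x∤1 | yes refl = ⊥-elim (x∤1 ∣-refl)
    ... | no  _   | no  _    = refl
  ∑∣≤-p^ (suc n) N f p^1+n≤N = begin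
    ∑∣≤ N (p ^ suc n) f
      ≡⟨ ∑<-cong N (λ {i} _ → indicator-∣p^1+n n (suc i) (f (suc i))) ⟩
    ∑< N (λ i → indicator (suc i ∣? p ^ n) (f (suc i)) + indicator (suc i ≟ p ^ suc n) (f (suc i)))
      ≡⟨ ∑<-+ N _ _ ⟩
    ∑∣≤ N (p ^ n) f + ∑< N (λ i → indicator (suc i ≟ p ^ suc n) (f (suc i)))
      ≡⟨ cong₂ _+_ (∑∣≤-p^ n N f (≤-trans (<⇒≤ (p^n<p^1+n n)) p^1+n≤N))
                   (∑<-indicator-≟ N f (m^n>0 p (suc n)) p^1+n≤N) ⟩
    ∑< (suc n) (f ∘ (p ^_)) + f (p ^ suc n)
      ∎
    where open ≡-Reasoning

  p^m/′p^n≡p^[m∸n] : ∀ {m n} → n ≤ m → p ^ m /′ p ^ n ≡ p ^ (m ∸ n)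
  p^m/′p^n≡p^[m∸n] {m} {n} n≤m = begin
    p ^ m /′ p ^ n                ≡⟨ cong (λ e → p ^ e /′ p ^ n) (m∸n+n≡m n≤m) ⟨
    p ^ (m ∸ n + n) /′ p ^ n      ≡⟨ cong (_/′ p ^ n) (^-distribˡ-+-* p (m ∸ n) n) ⟩
    p ^ (m ∸ n) * p ^ n /′ p ^ n  ≡⟨ m*n/′n≡m (p ^ (m ∸ n)) (p ^ n) (m^n>0 p n) ⟩
    p ^ (m ∸ n)                   ∎
    where open ≡-Reasoning

  factorisations-p^-suc : ∀ K j n → n ≤ K →
    factorisations (range2 (p ^ K)) (suc j) (p ^ n) ≡ ∑< n (factorisations (range2 (p ^ K)) j ∘ (p ^_))
  factorisations-p^-suc K j n n≤K = +-cancelˡ-≡ (F (p ^ n)) _ _ (begin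
    F (p ^ n) + factorisations L (suc j) (p ^ n)  ≡⟨ factorisations-range2-suc (p ^ K) j (p ^ n) (m^n>0 p K) ⟩
    ∑∣≤ (p ^ K) (p ^ n) (F ∘ (p ^ n /′_))         ≡⟨ ∑∣≤-p^ n (p ^ K) (F ∘ (p ^ n /′_)) (^-monoʳ-≤ p n≤K) ⟩
    ∑< (suc n) (λ e → F (p ^ n /′ p ^ e))         ≡⟨ ∑<-cong (suc n) (cong F ∘ p^m/′p^n≡p^[m∸n] ∘ m<1+n⇒m≤n) ⟩
    ∑< (suc n) (λ e → F (p ^ (n ∸ e)))            ≡⟨ ∑<-reverse (suc n) (F ∘ (p ^_)) ⟩
    ∑< n (F ∘ (p ^_)) + F (p ^ n)                 ≡⟨ +-comm _ (F (p ^ n)) ⟩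
    F (p ^ n) + ∑< n (F ∘ (p ^_))                 ∎)
    where
    open ≡-Reasoning
    L : List ℕ
    L = range2 (p ^ K)
    F : ℕ → ℕ
    F = factorisations L j

  factorisations-p^ : ∀ K j n → n ≤ K → factorisations (range2 (p ^ K)) (suc j) (p ^ n) ≡ n C⁻ j
  factorisations-p^ K zero n n≤K = trans (factorisations-p^-suc K 0 n n≤K) (∑<-F₀-p^ n)
    where
    F₀ : ℕ → ℕ
    F₀ = factorisations (range2 (p ^ K)) 0
    F₀-p^1+n : ∀ d → F₀ (p ^ suc d) ≡ 0
    F₀-p^1+n d rewrite factorisations-zero (range2 (p ^ K)) (p ^ suc d) with 1 ≟ p ^ suc d
    ... | yes 1≡p^1+d = ⊥-elim (<⇒≢ (^-monoʳ-< p 1<p (s≤s (z≤n {d}))) 1≡p^1+d)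
    ... | no  _       = refl
    ∑<-F₀-p^ : ∀ n → ∑< n (F₀ ∘ (p ^_)) ≡ n C⁻ 0
    ∑<-F₀-p^ zero    = refl
    ∑<-F₀-p^ (suc n) = trans (∑<-sucˡ n (F₀ ∘ (p ^_)))
      (cong (1 +_) (trans (∑<-cong n (λ {d} _ → F₀-p^1+n d)) (∑<-0 n)))
  factorisations-p^ K (suc j) n n≤K = begin
    factorisations L (suc (suc j)) (p ^ n)       ≡⟨ factorisations-p^-suc K (suc j) n n≤K ⟩
    ∑< n (factorisations L (suc j) ∘ (p ^_))     ≡⟨ ∑<-cong n (λ {d} d<n → factorisations-p^ K j d (≤-trans (<⇒≤ d<n) n≤K)) ⟩
    ∑< n (_C⁻ j)                                 ≡⟨ ∑<-C⁻ n j ⟩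
    n C⁻ suc j                                   ∎
    where
    open ≡-Reasoning
    L : List ℕ
    L = range2 (p ^ K)

  cr-suc-p^ : ∀ J r n → cr J (suc r) (p ^ n) ≡ ∑< (suc n) (cr J r ∘ (p ^_))
  cr-suc-p^ J r n = trans (sum-map-divisors (p ^ n) (cr J r)) (∑∣≤-p^ n (p ^ n) (cr J r) ≤-refl)

  cr-p^ : ∀ j r n → cr (suc j) r (p ^ n) ≡ (n + r) C⁻ (j + r)
  cr-p^ j zero    n = trans (factorisations-p^ n j n ≤-refl) (sym (cong₂ _C⁻_ (+-identityʳ n) (+-identityʳ j)))
  cr-p^ j (suc r) n = begin
    cr (suc j) (suc r) (p ^ n)                   ≡⟨ cr-suc-p^ (suc j) r n ⟩
    ∑< (suc n) (cr (suc j) r ∘ (p ^_))           ≡⟨ ∑<-cong (suc n) (λ {d} _ → cr-p^ j r d) ⟩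
    ∑< (suc n) (λ d → (d + r) C⁻ (j + r))        ≡⟨ ∑<-C⁻-shift (suc n) r (j + r) (m≤n+m r (suc j)) ⟩
    (suc n + r) C⁻ suc (j + r)                   ≡⟨ cong₂ _C⁻_ (+-suc n r) (+-suc j r) ⟨
    (n + suc r) C⁻ (j + suc r)                   ∎
    where open ≡-Reasoning

lemma20 : (j a r p : ℕ) → Prime p →
    cr (suc j) r (p ^ suc a) ≡ (suc a + r ∸ 1) C (suc j + r ∸ 1)
lemma20 j a r p prime-p = PrimePower.cr-p^ prime-p j r (suc a)
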